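{- The set $\mathcal{B}=\{\langle A,A\cap C,C\rangle : A,C\in\mathcal{F}(\kappa),\ A\sim C\}$ is a bounded Boolean sublattice of $\mathcal{S}$.
   Context: Let $\kappa$ be an infinite cardinal, identified with the set of ordinals less than $\kappa$. Let $\mathcal{F}(\kappa)=\{X\subseteq\kappa : X \text{ is finite or } \kappa\setminus X \text{ is finite}\}$. For $A,C\in\mathcal{F}(\kappa)$, write $A\sim C$ if either both $A$ and $C$ are finite, or both $\kappa\setminus A$ and $\kappa\setminus C$ are finite. For subsets $A,B,C\subseteq\kappa$ put $\mu\langle A,B,C\rangle=(A\cap B)\cup(A\cap C)\cup(B\cap C)$ and $\overline{\langle A,B,C\rangle}=\langle A\cup\mu,\ B\cup\mu,\ C\cup\mu\rangle$ with $\mu=\mu\langle A,B,C\rangle$. A triple is balanced if $A\cap B=A\cap C=B\cap C$. $M_3[\mathcal{F}(\kappa)]$ is the lattice of balanced triples in $\mathcal{F}(\kappa)^3$, ordered componentwise, with meet the componentwise intersection and join $\langle A,B,C\rangle\vee\langle A',B',C'\rangle=\overline{\langle A\cup A',B\cup B',C\cup C'\rangle}$. Let $\mathcal{S}=\{\langle A,B,C\rangle\in M_3[\mathcal{F}(\kappa)] : C\setminus\mu\langle A,B,C\rangle\text{ is finite}\}$, a bounded sublattice of $M_3[\mathcal{F}(\kappa)]$ with bounds $\langle\emptyset,\emptyset,\emptyset\rangle$ and $\langle\kappa,\kappa,\kappa\rangle$. -}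

module Defs where

open import Data.Bool using (Bool; true; false; _∧_; _∨_; not)
open import Data.List using (List)
open import Data.List.Membership.Propositional using (_∈_)
open import Data.Product using (Σ; ∃; _×_; _,_)
open import Data.Sum using (_⊎_)
open import Relation.Binary.PropositionalEquality using (_≡_)
open import Relation.Nullary using (¬_)

-- Subsets of the underlying set K (the elements of κ), as characteristic functions.
Subset : Set → Set
Subset K = K → Bool

module _ {K : Set} where

  ∅ₛ : Subset K
  ∅ₛ _ = false

  fullₛ : Subset K
  fullₛ _ = true

  _∩_ : Subset K → Subset K → Subset K
  (X ∩ Y) x = X x ∧ Y x

  _∪_ : Subset K → Subset K → Subset K
  (X ∪ Y) x = X x ∨ Y x

  _∖_ : Subset K → Subset K → Subset K
  (X ∖ Y) x = X x ∧ not (Y x)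

  _≐_ : Subset K → Subset K → Set
  X ≐ Y = ∀ x → X x ≡ Y x

  Finite : Subset K → Set
  Finite X = Σ (List K) λ xs → ∀ x → X x ≡ true → x ∈ xs

  Cofinite : Subset K → Set
  Cofinite X = Finite (fullₛ ∖ X)

  InF : Subset K → Set
  InF X = Finite X ⊎ Cofinite X

  _∼_ : Subset K → Subset K → Set
  A ∼ C = (Finite A × Finite C) ⊎ (Cofinite A × Cofinite C)

  record Triple : Set where
    constructor ⟨_,_,_⟩
    field
      fst snd thd : Subset K
  open Triple public

  _≈ₜ_ : Triple → Triple → Set
  s ≈ₜ t = (fst s ≐ fst t) × (snd s ≐ snd t) × (thd s ≐ thd t)

  μ : Triple → Subset K
  μ ⟨ A , B , C ⟩ = (A ∩ B) ∪ ((A ∩ C) ∪ (B ∩ C))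

  bar : Triple → Triple
  bar t@(⟨ A , B , C ⟩) = ⟨ A ∪ μ t , B ∪ μ t , C ∪ μ t ⟩

  Balanced : Triple → Set
  Balanced ⟨ A , B , C ⟩ = ((A ∩ B) ≐ (A ∩ C)) × ((A ∩ C) ≐ (B ∩ C))

  InM3 : Triple → Set
  InM3 t = InF (fst t) × InF (snd t) × InF (thd t) × Balanced t

  _⊓_ : Triple → Triple → Triple
  ⟨ A , B , C ⟩ ⊓ ⟨ A' , B' , C' ⟩ = ⟨ A ∩ A' , B ∩ B' , C ∩ C' ⟩

  _⊔_ : Triple → Triple → Triple
  ⟨ A , B , C ⟩ ⊔ ⟨ A' , B' , C' ⟩ = bar ⟨ A ∪ A' , B ∪ B' , C ∪ C' ⟩

  ⊥ₜ : Triple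
  ⊥ₜ = ⟨ ∅ₛ , ∅ₛ , ∅ₛ ⟩

  ⊤ₜ : Triple
  ⊤ₜ = ⟨ fullₛ , fullₛ , fullₛ ⟩

  InS : Triple → Set
  InS t = InM3 t × Finite (thd t ∖ μ t)

  InB : Triple → Set
  InB t = ∃ λ A → ∃ λ C → InF A × InF C × (A ∼ C) × (t ≈ₜ ⟨ A , A ∩ C , C ⟩)

  record IsBoundedBooleanSublatticeOfS (P : Triple → Set) : Set where
    field
      ⊆S        : ∀ t → P t → InS t
      has-⊥     : P ⊥ₜ
      has-⊤     : P ⊤ₜ
      closed-⊓  : ∀ s t → P s → P t → P (s ⊓ t)
      closed-⊔  : ∀ s t → P s → P t → P (s ⊔ t)
      distrib-⊓ : ∀ r s t → P r → P s → P t → (r ⊓ (s ⊔ t)) ≈ₜ ((r ⊓ s) ⊔ (r ⊓ t))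
      distrib-⊔ : ∀ r s t → P r → P s → P t → (r ⊔ (s ⊓ t)) ≈ₜ ((r ⊔ s) ⊓ (r ⊔ t))
      complement : ∀ s → P s → Σ Triple λ t → P t × ((s ⊓ t) ≈ₜ ⊥ₜ) × ((s ⊔ t) ≈ₜ ⊤ₜ)

Infinite : Set → Set
Infinite K = ¬ Finite {K} fullₛ

-- All operations on triples act pointwise, and at a point ⟨A, A∩C, C⟩ is ⟨a, a∧c, c⟩.
-- The middle component of the componentwise union of two such triples still lies below
-- the meet of the outer ones, so the median closure in ⊔ just resets it to that meet.
-- Hence (A, C) ↦ ⟨A, A∩C, C⟩ turns componentwise ∩, ∪ into ⊓, ⊔, and 𝓑 is the image
-- of the Boolean algebra of pairs A ∼ C, which is closed under ∩, ∪ and complement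
-- because the finite sets form an ideal and the cofinite sets the dual filter.
-- Membership in 𝓢 comes from C ∖ μ = C ∖ A, a subset of C when both are finite and
-- of κ ∖ A when both are cofinite.

module Submission where

open import Defs
open import Data.Bool using (true; false; _∧_; _∨_; not; _≤_; f≤t; b≤b)
open import Data.Bool.Properties
  using ( ≤-reflexive; ≤-minimum; ≤-maximum; not-involutive; ∧-inverseʳ; ∨-inverseʳ
        ; ∧-distribˡ-∨; ∨-distribˡ-∧; ∧-commutativeMonoid )
open import Algebra.Bundles using (CommutativeMonoid)
open import Algebra.Properties.CommutativeSemigroup
  (CommutativeMonoid.commutativeSemigroup ∧-commutativeMonoid) using (interchange)
open import Data.List using ([]; _++_)
open import Data.List.Membership.Propositional using (_∈_)
open import Data.List.Membership.Propositional.Properties using (∈-++⁺ˡ; ∈-++⁺ʳ)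
open import Data.Product using (Σ; _×_; _,_; proj₁; proj₂)
open import Data.Sum using (inj₁; inj₂)
open import Relation.Binary.Bundles using (Setoid)
import Relation.Binary.Reasoning.Setoid as SetoidReasoning
open import Relation.Binary.PropositionalEquality using (_≡_; refl; sym; trans; cong; cong₂)

∧-≤ˡ : ∀ a b → a ∧ b ≤ a
∧-≤ˡ true  b = ≤-maximum b
∧-≤ˡ false b = b≤b

∧-≤ʳ : ∀ a b → a ∧ b ≤ b
∧-≤ʳ true  b = b≤b
∧-≤ʳ false b = ≤-minimum b

≤-∨ˡ : ∀ a b → a ≤ a ∨ b
≤-∨ˡ true  b = b≤b
≤-∨ˡ false b = ≤-minimum b

≤-∨ʳ : ∀ a b → b ≤ a ∨ b
≤-∨ʳ true  b = ≤-maximum b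
≤-∨ʳ false b = b≤b

not-antimono-≤ : ∀ {a b} → a ≤ b → not b ≤ not a
not-antimono-≤ f≤t = f≤t
not-antimono-≤ b≤b = b≤b

not-∧-≤ : ∀ a b → not (a ∧ b) ≤ not a ∨ not b
not-∧-≤ true  b = b≤b
not-∧-≤ false b = b≤b

≤-true : ∀ {a b} → a ≤ b → a ≡ true → b ≡ true
≤-true b≤b a≡true = a≡true

∨-∧-≤-∧-∨ : ∀ a c a′ c′ → (a ∧ c) ∨ (a′ ∧ c′) ≤ (a ∨ a′) ∧ (c ∨ c′)
∨-∧-≤-∧-∨ true  true  a′    c′ = b≤b
∨-∧-≤-∧-∨ true  false true  c′ = b≤b
∨-∧-≤-∧-∨ true  false false c′ = ≤-minimum c′
∨-∧-≤-∧-∨ false true  true  c′ = ≤-maximum c′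
∨-∧-≤-∧-∨ false true  false c′ = b≤b
∨-∧-≤-∧-∨ false false a′    c′ = b≤b

median-closure-below : ∀ p q r → q ≤ p ∧ r →
  let m = (p ∧ q) ∨ ((p ∧ r) ∨ (q ∧ r))
  in (p ∨ m ≡ p) × (q ∨ m ≡ p ∧ r) × (r ∨ m ≡ r)
median-closure-below true  q     true  f≤t = refl , refl , refl
median-closure-below true  true  true  b≤b = refl , refl , refl
median-closure-below true  false false b≤b = refl , refl , refl
median-closure-below false false true  b≤b = refl , refl , refl
median-closure-below false false false b≤b = refl , refl , refl

module _ {K : Set} where

  infix 4 _⊆_

  _⊆_ : Subset K → Subset K → Set
  X ⊆ Y = ∀ x → X x ≤ Y x

  ∁ : Subset K → Subset K
  ∁ X = fullₛ ∖ X

  ∩-cong : {X X′ Y Y′ : Subset K} → X ≐ X′ → Y ≐ Y′ → (X ∩ Y) ≐ (X′ ∩ Y′)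
  ∩-cong X≐X′ Y≐Y′ x = cong₂ _∧_ (X≐X′ x) (Y≐Y′ x)

  ∪-cong : {X X′ Y Y′ : Subset K} → X ≐ X′ → Y ≐ Y′ → (X ∪ Y) ≐ (X′ ∪ Y′)
  ∪-cong X≐X′ Y≐Y′ x = cong₂ _∨_ (X≐X′ x) (Y≐Y′ x)

  ∖-cong : {X X′ Y Y′ : Subset K} → X ≐ X′ → Y ≐ Y′ → (X ∖ Y) ≐ (X′ ∖ Y′)
  ∖-cong X≐X′ Y≐Y′ x = cong₂ (λ a b → a ∧ not b) (X≐X′ x) (Y≐Y′ x)

  ∁-cong : {X Y : Subset K} → X ≐ Y → ∁ X ≐ ∁ Y
  ∁-cong X≐Y x = cong not (X≐Y x)

  ∁-antimono : {X Y : Subset K} → X ⊆ Y → ∁ Y ⊆ ∁ X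
  ∁-antimono X⊆Y x = not-antimono-≤ (X⊆Y x)

  ∩-distribˡ-∪ : (X Y Z : Subset K) → (X ∩ (Y ∪ Z)) ≐ ((X ∩ Y) ∪ (X ∩ Z))
  ∩-distribˡ-∪ X Y Z x = ∧-distribˡ-∨ (X x) (Y x) (Z x)

  ∪-distribˡ-∩ : (X Y Z : Subset K) → (X ∪ (Y ∩ Z)) ≐ ((X ∪ Y) ∩ (X ∪ Z))
  ∪-distribˡ-∩ X Y Z x = ∨-distribˡ-∧ (X x) (Y x) (Z x)

  ∩-∁ : (X : Subset K) → (X ∩ ∁ X) ≐ ∅ₛ
  ∩-∁ X x = ∧-inverseʳ (X x)

  ∪-∁ : (X : Subset K) → (X ∪ ∁ X) ≐ fullₛ
  ∪-∁ X x = ∨-inverseʳ (X x)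

  finite-∅ : Finite {K} ∅ₛ
  finite-∅ = [] , λ _ ()

  finite-mono : {X Y : Subset K} → X ⊆ Y → Finite Y → Finite X
  finite-mono X⊆Y (xs , Y⊆xs) = xs , λ x x∈X → Y⊆xs x (≤-true (X⊆Y x) x∈X)

  finite-resp : {X Y : Subset K} → X ≐ Y → Finite X → Finite Y
  finite-resp X≐Y = finite-mono λ x → ≤-reflexive (sym (X≐Y x))

  finite-∪ : {X Y : Subset K} → Finite X → Finite Y → Finite (X ∪ Y)
  finite-∪ {X} {Y} (xs , X⊆xs) (ys , Y⊆ys) = xs ++ ys , λ x → split x (X x) refl
    where
    split : ∀ x b → X x ≡ b → b ∨ Y x ≡ true → x ∈ xs ++ ys
    split x true  x∈X _   = ∈-++⁺ˡ (X⊆xs x x∈X)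
    split x false _   x∈Y = ∈-++⁺ʳ xs (Y⊆ys x x∈Y)

  cofinite-mono : {X Y : Subset K} → X ⊆ Y → Cofinite X → Cofinite Y
  cofinite-mono X⊆Y = finite-mono (∁-antimono X⊆Y)

  cofinite-∩ : {X Y : Subset K} → Cofinite X → Cofinite Y → Cofinite (X ∩ Y)
  cofinite-∩ {X} {Y} cofX cofY =
    finite-mono (λ x → not-∧-≤ (X x) (Y x)) (finite-∪ cofX cofY)

  finite⇒cofinite-∁ : {X : Subset K} → Finite X → Cofinite (∁ X)
  finite⇒cofinite-∁ {X} = finite-mono λ x → ≤-reflexive (not-involutive (X x))

  InF-resp : {X Y : Subset K} → X ≐ Y → InF X → InF Y
  InF-resp X≐Y (inj₁ finX) = inj₁ (finite-resp X≐Y finX)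
  InF-resp X≐Y (inj₂ cofX) = inj₂ (finite-resp (∁-cong X≐Y) cofX)

  InF-∩ : {X Y : Subset K} → InF X → InF Y → InF (X ∩ Y)
  InF-∩ {X} {Y} (inj₁ finX) _           = inj₁ (finite-mono (λ x → ∧-≤ˡ (X x) (Y x)) finX)
  InF-∩ {X} {Y} (inj₂ _)    (inj₁ finY) = inj₁ (finite-mono (λ x → ∧-≤ʳ (X x) (Y x)) finY)
  InF-∩         (inj₂ cofX) (inj₂ cofY) = inj₂ (cofinite-∩ cofX cofY)

  InF-∪ : {X Y : Subset K} → InF X → InF Y → InF (X ∪ Y)
  InF-∪ {X} {Y} (inj₂ cofX) _           = inj₂ (cofinite-mono (λ x → ≤-∨ˡ (X x) (Y x)) cofX)
  InF-∪ {X} {Y} (inj₁ _)    (inj₂ cofY) = inj₂ (cofinite-mono (λ x → ≤-∨ʳ (X x) (Y x)) cofY)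
  InF-∪         (inj₁ finX) (inj₁ finY) = inj₁ (finite-∪ finX finY)

  InF-∁ : {X : Subset K} → InF X → InF (∁ X)
  InF-∁ (inj₁ finX) = inj₂ (finite⇒cofinite-∁ finX)
  InF-∁ (inj₂ cofX) = inj₁ cofX

  ∼-∩ : {A C A′ C′ : Subset K} → A ∼ C → A′ ∼ C′ → (A ∩ A′) ∼ (C ∩ C′)
  ∼-∩ (inj₁ (finA , finC)) _ =
    inj₁ (finite-mono (λ x → ∧-≤ˡ _ _) finA , finite-mono (λ x → ∧-≤ˡ _ _) finC)
  ∼-∩ (inj₂ _) (inj₁ (finA′ , finC′)) =
    inj₁ (finite-mono (λ x → ∧-≤ʳ _ _) finA′ , finite-mono (λ x → ∧-≤ʳ _ _) finC′)
  ∼-∩ (inj₂ (cofA , cofC)) (inj₂ (cofA′ , cofC′)) =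
    inj₂ (cofinite-∩ cofA cofA′ , cofinite-∩ cofC cofC′)

  ∼-∪ : {A C A′ C′ : Subset K} → A ∼ C → A′ ∼ C′ → (A ∪ A′) ∼ (C ∪ C′)
  ∼-∪ (inj₂ (cofA , cofC)) _ =
    inj₂ (cofinite-mono (λ x → ≤-∨ˡ _ _) cofA , cofinite-mono (λ x → ≤-∨ˡ _ _) cofC)
  ∼-∪ (inj₁ _) (inj₂ (cofA′ , cofC′)) =
    inj₂ (cofinite-mono (λ x → ≤-∨ʳ _ _) cofA′ , cofinite-mono (λ x → ≤-∨ʳ _ _) cofC′)
  ∼-∪ (inj₁ (finA , finC)) (inj₁ (finA′ , finC′)) =
    inj₁ (finite-∪ finA finA′ , finite-∪ finC finC′)

  ∼-∁ : {A C : Subset K} → A ∼ C → ∁ A ∼ ∁ C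
  ∼-∁ (inj₁ (finA , finC)) = inj₂ (finite⇒cofinite-∁ finA , finite⇒cofinite-∁ finC)
  ∼-∁ (inj₂ (cofA , cofC)) = inj₁ (cofA , cofC)

  ∼⇒finite-∖ : {A C : Subset K} → A ∼ C → Finite (C ∖ A)
  ∼⇒finite-∖ (inj₁ (_ , finC)) = finite-mono (λ x → ∧-≤ˡ _ _) finC
  ∼⇒finite-∖ (inj₂ (cofA , _)) = finite-mono (λ x → ∧-≤ʳ _ _) cofA

  ≈ₜ-refl : {t : Triple {K}} → t ≈ₜ t
  ≈ₜ-refl = (λ _ → refl) , (λ _ → refl) , (λ _ → refl)

  ≈ₜ-sym : {s t : Triple {K}} → s ≈ₜ t → t ≈ₜ s
  ≈ₜ-sym (e₁ , e₂ , e₃) = (λ x → sym (e₁ x)) , (λ x → sym (e₂ x)) , (λ x → sym (e₃ x))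

  ≈ₜ-trans : {r s t : Triple {K}} → r ≈ₜ s → s ≈ₜ t → r ≈ₜ t
  ≈ₜ-trans (e₁ , e₂ , e₃) (f₁ , f₂ , f₃) =
    (λ x → trans (e₁ x) (f₁ x)) , (λ x → trans (e₂ x) (f₂ x)) , (λ x → trans (e₃ x) (f₃ x))

  ≈ₜ-setoid : Setoid _ _
  ≈ₜ-setoid = record
    { Carrier       = Triple {K}
    ; _≈_           = _≈ₜ_
    ; isEquivalence = record { refl = ≈ₜ-refl ; sym = ≈ₜ-sym ; trans = ≈ₜ-trans }
    }

  μ-cong : {s t : Triple {K}} → s ≈ₜ t → μ s ≐ μ t
  μ-cong (e₁ , e₂ , e₃) = ∪-cong (∩-cong e₁ e₂) (∪-cong (∩-cong e₁ e₃) (∩-cong e₂ e₃))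

  bar-cong : {s t : Triple {K}} → s ≈ₜ t → bar s ≈ₜ bar t
  bar-cong s≈t@(e₁ , e₂ , e₃) = ∪-cong e₁ μs≐μt , ∪-cong e₂ μs≐μt , ∪-cong e₃ μs≐μt
    where μs≐μt = μ-cong s≈t

  ⊓-cong : {s s′ t t′ : Triple {K}} → s ≈ₜ s′ → t ≈ₜ t′ → (s ⊓ t) ≈ₜ (s′ ⊓ t′)
  ⊓-cong (e₁ , e₂ , e₃) (f₁ , f₂ , f₃) = ∩-cong e₁ f₁ , ∩-cong e₂ f₂ , ∩-cong e₃ f₃

  ⊔-cong : {s s′ t t′ : Triple {K}} → s ≈ₜ s′ → t ≈ₜ t′ → (s ⊔ t) ≈ₜ (s′ ⊔ t′)
  ⊔-cong (e₁ , e₂ , e₃) (f₁ , f₂ , f₃) = bar-cong (∪-cong e₁ f₁ , ∪-cong e₂ f₂ , ∪-cong e₃ f₃)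

  Balanced-resp : {s t : Triple {K}} → s ≈ₜ t → Balanced s → Balanced t
  Balanced-resp (e₁ , e₂ , e₃) (AB≐AC , AC≐BC) =
    (λ x → trans (sym (∩-cong e₁ e₂ x)) (trans (AB≐AC x) (∩-cong e₁ e₃ x))) ,
    (λ x → trans (sym (∩-cong e₁ e₃ x)) (trans (AC≐BC x) (∩-cong e₂ e₃ x)))

  InS-resp : {s t : Triple {K}} → s ≈ₜ t → InS s → InS t
  InS-resp s≈t@(e₁ , e₂ , e₃) ((InF-A , InF-B , InF-C , balanced) , finite-C∖μ) =
    (InF-resp e₁ InF-A , InF-resp e₂ InF-B , InF-resp e₃ InF-C , Balanced-resp s≈t balanced) ,
    finite-resp (∖-cong e₃ (μ-cong s≈t)) finite-C∖μ

  ⟪_,_⟫ : Subset K → Subset K → Triple {K}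
  ⟪ A , C ⟫ = ⟨ A , A ∩ C , C ⟩

  ⟪⟫-cong : {A A′ C C′ : Subset K} → A ≐ A′ → C ≐ C′ → ⟪ A , C ⟫ ≈ₜ ⟪ A′ , C′ ⟫
  ⟪⟫-cong A≐A′ C≐C′ = A≐A′ , ∩-cong A≐A′ C≐C′ , C≐C′

  ⟪⟫-balanced : (A C : Subset K) → Balanced ⟪ A , C ⟫
  ⟪⟫-balanced A C = (λ x → absorbˡ (A x) (C x)) , (λ x → absorbʳ (A x) (C x))
    where
    absorbˡ : ∀ a c → a ∧ (a ∧ c) ≡ a ∧ c
    absorbˡ true  c = refl
    absorbˡ false c = refl
    absorbʳ : ∀ a c → a ∧ c ≡ (a ∧ c) ∧ c
    absorbʳ true  true  = refl
    absorbʳ true  false = refl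
    absorbʳ false c     = refl

  ⟪⟫-∖-μ : (A C : Subset K) → (C ∖ μ ⟪ A , C ⟫) ≐ (C ∖ A)
  ⟪⟫-∖-μ A C x = pointwise (A x) (C x)
    where
    pointwise : ∀ a c → c ∧ not ((a ∧ (a ∧ c)) ∨ ((a ∧ c) ∨ ((a ∧ c) ∧ c))) ≡ c ∧ not a
    pointwise true  true  = refl
    pointwise true  false = refl
    pointwise false c     = refl

  ⟪⟫-InS : {A C : Subset K} → InF A → InF C → A ∼ C → InS ⟪ A , C ⟫
  ⟪⟫-InS {A} {C} InF-A InF-C A∼C =
    (InF-A , InF-∩ InF-A InF-C , InF-C , ⟪⟫-balanced A C) ,
    finite-resp (λ x → sym (⟪⟫-∖-μ A C x)) (∼⇒finite-∖ A∼C)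

  bar-below : {P Q R : Subset K} → Q ⊆ P ∩ R → bar ⟨ P , Q , R ⟩ ≈ₜ ⟪ P , R ⟫
  bar-below {P} {Q} {R} Q⊆P∩R =
    (λ x → proj₁ (median x)) , (λ x → proj₁ (proj₂ (median x))) , (λ x → proj₂ (proj₂ (median x)))
    where
    t : Triple {K}
    t = bar ⟨ P , Q , R ⟩
    median : ∀ x → (fst t x ≡ P x) × (snd t x ≡ (P ∩ R) x) × (thd t x ≡ R x)
    median x = median-closure-below (P x) (Q x) (R x) (Q⊆P∩R x)

  ⟪⟫-⊓ : (A C A′ C′ : Subset K) → (⟪ A , C ⟫ ⊓ ⟪ A′ , C′ ⟫) ≈ₜ ⟪ A ∩ A′ , C ∩ C′ ⟫
  ⟪⟫-⊓ A C A′ C′ = (λ _ → refl) , (λ x → interchange (A x) (C x) (A′ x) (C′ x)) , (λ _ → refl)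

  ⟪⟫-⊔ : (A C A′ C′ : Subset K) → (⟪ A , C ⟫ ⊔ ⟪ A′ , C′ ⟫) ≈ₜ ⟪ A ∪ A′ , C ∪ C′ ⟫
  ⟪⟫-⊔ A C A′ C′ = bar-below λ x → ∨-∧-≤-∧-∨ (A x) (C x) (A′ x) (C′ x)

  ⊓-resp-⟪⟫ : {s t : Triple {K}} {A C A′ C′ : Subset K} →
    s ≈ₜ ⟪ A , C ⟫ → t ≈ₜ ⟪ A′ , C′ ⟫ → (s ⊓ t) ≈ₜ ⟪ A ∩ A′ , C ∩ C′ ⟫
  ⊓-resp-⟪⟫ {A = A} {C} {A′} {C′} s≈ t≈ = ≈ₜ-trans (⊓-cong s≈ t≈) (⟪⟫-⊓ A C A′ C′)

  ⊔-resp-⟪⟫ : {s t : Triple {K}} {A C A′ C′ : Subset K} →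
    s ≈ₜ ⟪ A , C ⟫ → t ≈ₜ ⟪ A′ , C′ ⟫ → (s ⊔ t) ≈ₜ ⟪ A ∪ A′ , C ∪ C′ ⟫
  ⊔-resp-⟪⟫ {A = A} {C} {A′} {C′} s≈ t≈ = ≈ₜ-trans (⊔-cong s≈ t≈) (⟪⟫-⊔ A C A′ C′)

  InB⇒InS : {t : Triple {K}} → InB t → InS t
  InB⇒InS (A , C , InF-A , InF-C , A∼C , t≈) = InS-resp (≈ₜ-sym t≈) (⟪⟫-InS InF-A InF-C A∼C)

  InB-⊥ₜ : InB {K} ⊥ₜ
  InB-⊥ₜ = ∅ₛ , ∅ₛ , inj₁ finite-∅ , inj₁ finite-∅ , inj₁ (finite-∅ , finite-∅) , ≈ₜ-refl

  InB-⊤ₜ : InB {K} ⊤ₜ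
  InB-⊤ₜ = fullₛ , fullₛ , inj₂ finite-∅ , inj₂ finite-∅ , inj₂ (finite-∅ , finite-∅) , ≈ₜ-refl

  InB-⊓ : {s t : Triple {K}} → InB s → InB t → InB (s ⊓ t)
  InB-⊓ (A , C , InF-A , InF-C , A∼C , s≈) (A′ , C′ , InF-A′ , InF-C′ , A′∼C′ , t≈) =
    A ∩ A′ , C ∩ C′ , InF-∩ InF-A InF-A′ , InF-∩ InF-C InF-C′ , ∼-∩ A∼C A′∼C′ , ⊓-resp-⟪⟫ s≈ t≈

  InB-⊔ : {s t : Triple {K}} → InB s → InB t → InB (s ⊔ t)
  InB-⊔ (A , C , InF-A , InF-C , A∼C , s≈) (A′ , C′ , InF-A′ , InF-C′ , A′∼C′ , t≈) =
    A ∪ A′ , C ∪ C′ , InF-∪ InF-A InF-A′ , InF-∪ InF-C InF-C′ , ∼-∪ A∼C A′∼C′ , ⊔-resp-⟪⟫ s≈ t≈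

  ⊓-distribˡ-⊔-InB : {r s t : Triple {K}} → InB r → InB s → InB t →
    (r ⊓ (s ⊔ t)) ≈ₜ ((r ⊓ s) ⊔ (r ⊓ t))
  ⊓-distribˡ-⊔-InB {r} {s} {t}
    (A , C , _ , _ , _ , r≈) (A′ , C′ , _ , _ , _ , s≈) (A″ , C″ , _ , _ , _ , t≈) =
    begin
      r ⊓ (s ⊔ t)                                    ≈⟨ ⊓-resp-⟪⟫ r≈ (⊔-resp-⟪⟫ s≈ t≈) ⟩
      ⟪ A ∩ (A′ ∪ A″) , C ∩ (C′ ∪ C″) ⟫              ≈⟨ ⟪⟫-cong (∩-distribˡ-∪ A A′ A″) (∩-distribˡ-∪ C C′ C″) ⟩
      ⟪ (A ∩ A′) ∪ (A ∩ A″) , (C ∩ C′) ∪ (C ∩ C″) ⟫  ≈⟨ ⊔-resp-⟪⟫ (⊓-resp-⟪⟫ r≈ s≈) (⊓-resp-⟪⟫ r≈ t≈) ⟨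
      (r ⊓ s) ⊔ (r ⊓ t)                              ∎
    where open SetoidReasoning ≈ₜ-setoid

  ⊔-distribˡ-⊓-InB : {r s t : Triple {K}} → InB r → InB s → InB t →
    (r ⊔ (s ⊓ t)) ≈ₜ ((r ⊔ s) ⊓ (r ⊔ t))
  ⊔-distribˡ-⊓-InB {r} {s} {t}
    (A , C , _ , _ , _ , r≈) (A′ , C′ , _ , _ , _ , s≈) (A″ , C″ , _ , _ , _ , t≈) =
    begin
      r ⊔ (s ⊓ t)                                    ≈⟨ ⊔-resp-⟪⟫ r≈ (⊓-resp-⟪⟫ s≈ t≈) ⟩
      ⟪ A ∪ (A′ ∩ A″) , C ∪ (C′ ∩ C″) ⟫              ≈⟨ ⟪⟫-cong (∪-distribˡ-∩ A A′ A″) (∪-distribˡ-∩ C C′ C″) ⟩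
      ⟪ (A ∪ A′) ∩ (A ∪ A″) , (C ∪ C′) ∩ (C ∪ C″) ⟫  ≈⟨ ⊓-resp-⟪⟫ (⊔-resp-⟪⟫ r≈ s≈) (⊔-resp-⟪⟫ r≈ t≈) ⟨
      (r ⊔ s) ⊓ (r ⊔ t)                              ∎
    where open SetoidReasoning ≈ₜ-setoid

  InB-complement : {s : Triple {K}} → InB s →
    Σ (Triple {K}) λ t → InB t × ((s ⊓ t) ≈ₜ ⊥ₜ) × ((s ⊔ t) ≈ₜ ⊤ₜ)
  InB-complement (A , C , InF-A , InF-C , A∼C , s≈) =
    ⟪ ∁ A , ∁ C ⟫ ,
    (∁ A , ∁ C , InF-∁ InF-A , InF-∁ InF-C , ∼-∁ A∼C , ≈ₜ-refl) ,
    ≈ₜ-trans (⊓-resp-⟪⟫ s≈ ≈ₜ-refl) (⟪⟫-cong (∩-∁ A) (∩-∁ C)) ,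
    ≈ₜ-trans (⊔-resp-⟪⟫ s≈ ≈ₜ-refl) (⟪⟫-cong (∪-∁ A) (∪-∁ C))

lemma5p3 : (K : Set) → Infinite K → IsBoundedBooleanSublatticeOfS {K} InB
lemma5p3 K _ = record
  { ⊆S         = λ _ → InB⇒InS
  ; has-⊥      = InB-⊥ₜ
  ; has-⊤      = InB-⊤ₜ
  ; closed-⊓   = λ _ _ → InB-⊓
  ; closed-⊔   = λ _ _ → InB-⊔
  ; distrib-⊓  = λ _ _ _ → ⊓-distribˡ-⊔-InB
  ; distrib-⊔  = λ _ _ _ → ⊔-distribˡ-⊓-InB
  ; complement = λ _ → InB-complement
  }
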